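{- Fix gridded permutations $g$ and $h$ and a cell $c\in\mathbb{N}^2$. If some multiplex of $g$ around $c$ contains some multiplex of $h$ around $c$ (i.e., there are $g'\in M_c(g)$ and $h'\in M_c(h)$ with $h'\le g'$), then $h\le g$.
   Context: A gridded permutation of size $n$ is a pair $(\pi,(c_1,\ldots,c_n))$ with $\pi$ a permutation of $\{1,\ldots,n\}$ and cells $c_i=(x_i,y_i)\in\mathbb{N}^2$ such that $x_i\le x_j$ whenever $i<j$ and $y_i\le y_j$ whenever $\pi(i)<\pi(j)$. Containment $h\le g$ for $g=(\pi,(c_i))$, $h=(\sigma,(d_j))$ of size $k$: there are indices $i_1<\cdots<i_k$ with $\pi(i_1)\cdots\pi(i_k)$ order-isomorphic to $\sigma$ and $c_{i_j}=d_j$ for all $j$. For $p\in\mathbb{N}$ let $b_p(i)=i$ if $i<p$, $b_p(i)=p$ if $i\in\{p,p+1,p+2\}$, $b_p(i)=i-2$ if $i>p+2$; for $c=(c_x,c_y)$ let $\beta_c(a,b)=(b_{c_x}(a),b_{c_y}(b))$. The set of multiplexes of $g=(\pi,(c_1,\ldots,c_n))$ around $c$ is $M_c(g)=\{(\pi,(c'_1,\ldots,c'_n)) \text{ a gridded permutation} : \beta_c(c'_i)=c_i \text{ for } 1\le i\le n\}$. -}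

module Defs where

open import Data.Nat using (ℕ; _<_; _≤_; _∸_; _+_; _<?_; _≤?_)
open import Data.Fin using (Fin)
import Data.Fin as F
open import Data.Fin.Permutation using (Permutation′; _⟨$⟩ʳ_)
open import Data.Product using (_×_; _,_; Σ; ∃; proj₁; proj₂)
open import Relation.Binary.PropositionalEquality using (_≡_)
open import Relation.Nullary using (yes; no)
open import Function.Bundles using (_⇔_)

Cell : Set
Cell = ℕ × ℕ

record RawGP : Set where
  constructor mkRaw
  field
    size  : ℕ
    perm  : Permutation′ size
    cells : Fin size → Cell
open RawGP public

IsGridded : RawGP → Set
IsGridded g =
  (∀ (i j : Fin (size g)) → i F.< j → proj₁ (cells g i) ≤ proj₁ (cells g j)) ×
  (∀ (i j : Fin (size g)) → (perm g ⟨$⟩ʳ i) F.< (perm g ⟨$⟩ʳ j) →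
        proj₂ (cells g i) ≤ proj₂ (cells g j))

GriddedPerm : Set
GriddedPerm = Σ RawGP IsGridded

_≼_ : GriddedPerm → GriddedPerm → Set
(h , _) ≼ (g , _) =
  Σ (Fin (size h) → Fin (size g)) λ e →
    (∀ a b → a F.< b → e a F.< e b) ×
    (∀ a b → ((perm h ⟨$⟩ʳ a) F.< (perm h ⟨$⟩ʳ b)) ⇔
             ((perm g ⟨$⟩ʳ e a) F.< (perm g ⟨$⟩ʳ e b))) ×
    (∀ a → cells g (e a) ≡ cells h a)

bmap : ℕ → ℕ → ℕ
bmap p i with i <? p
... | yes _ = i
... | no _ with i ≤? p + 2
...   | yes _ = p
...   | no _  = i ∸ 2

β : Cell → Cell → Cell
β (cx , cy) (a , b) = bmap cx a , bmap cy b

Multiplex : Cell → GriddedPerm → Set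
Multiplex c (g , _) =
  Σ (Fin (size g) → Cell) λ c' →
    IsGridded (mkRaw (size g) (perm g) c') × (∀ i → β c (c' i) ≡ cells g i)

toGP : (c : Cell) (g : GriddedPerm) → Multiplex c g → GriddedPerm
toGP c (g , _) (c' , gr , _) = mkRaw (size g) (perm g) c' , gr

{-# OPTIONS --safe #-}
module Submission where

open import Defs
open import Data.Fin using (Fin)
open import Data.Product using (Σ; _×_; _,_)
open import Relation.Binary.PropositionalEquality using (_≡_; cong; module ≡-Reasoning)

-- Multiplex c is Lift (β c) definitionally; nothing below depends on β.
Lift : (Cell → Cell) → GriddedPerm → Set
Lift f (g , _) =
  Σ (Fin (size g) → Cell) λ c′ →
    IsGridded (mkRaw (size g) (perm g) c′) × (∀ i → f (c′ i) ≡ cells g i)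

liftGP : (f : Cell → Cell) (g : GriddedPerm) → Lift f g → GriddedPerm
liftGP f (g , _) (c′ , gridded , _) = mkRaw (size g) (perm g) c′ , gridded

-- The order conditions of ≼ do not see the cells, so the same embedding
-- works; only the cell condition needs f applied to both sides.
≼-unlift : (f : Cell → Cell) (g h : GriddedPerm)
  (g′ : Lift f g) (h′ : Lift f h) → liftGP f h h′ ≼ liftGP f g g′ → h ≼ g
≼-unlift f (g , _) (h , _) (cg′ , _ , g′-over) (ch′ , _ , h′-over)
         (e , e-mono , e-iso , e-cells) = e , e-mono , e-iso , e-cells-down
  where
  open ≡-Reasoning
  e-cells-down : ∀ a → cells g (e a) ≡ cells h a
  e-cells-down a = begin
    cells g (e a)    ≡⟨ g′-over (e a) ⟨
    f (cg′ (e a))    ≡⟨ cong f (e-cells a) ⟩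
    f (ch′ a)        ≡⟨ h′-over a ⟩
    cells h a        ∎

lemma6p6 : (g h : GriddedPerm) (c : Cell) →
    (g' : Multiplex c g) (h' : Multiplex c h) →
    toGP c h h' ≼ toGP c g g' → h ≼ g
lemma6p6 g h c = ≼-unlift (β c) g h
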